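{- For any integer $m\ge 2$ and any $n\in\mathbb{N}$, $g_m(n)=n$ if and only if $n=k^d$ for some $k,d\in\mathbb{N}$ with $\gcd(d,m)>1$.
   Context: $\mathbb{N}=\{0,1,2,\dots\}$. For an integer $m\ge 2$, an $m$-product sequence is a finite sequence of integers $a_1\le a_2\le\dots\le a_t$ such that $\prod_{i=1}^t a_i=R^m$ for some $R\in\mathbb{N}$ and no integer appears more than $m-1$ times in the sequence. For $n\in\mathbb{N}$, $g_m(n)$ is the least integer $s$ such that there exists an $m$-product sequence $a_1\le\dots\le a_t$ with $a_1=n$ and $a_t=s$. -}

module Defs where

open import Data.Nat using (ℕ; _≤_; _∸_)
open import Data.Integer using (ℤ; +_; _*_; _^_) renaming (_≤_ to _≤ℤ_)
import Data.Integer.Properties as ℤP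
open import Data.List using (List; foldr; length; filter; head; last)
open import Data.List.Relation.Unary.Sorted.TotalOrder ℤP.≤-totalOrder using (Sorted)
open import Data.Maybe using (just)
open import Data.Product using (Σ; ∃; _×_)
open import Relation.Binary.PropositionalEquality using (_≡_)

prodℤ : List ℤ → ℤ
prodℤ = foldr _*_ (+ 1)

occ : ℤ → List ℤ → ℕ
occ x as = length (filter (Data.Integer._≟ x) as)
  where import Data.Integer

record IsMProductSeq (m : ℕ) (as : List ℤ) : Set where
  field
    sorted   : Sorted as
    power    : ∃ λ (R : ℕ) → prodℤ as ≡ (+ R) ^ m
    multiple : ∀ (x : ℤ) → occ x as ≤ m ∸ 1

Achievable : ℕ → ℕ → ℤ → Set
Achievable m n s = ∃ λ (as : List ℤ) →
  IsMProductSeq m as × head as ≡ just (+ n) × last as ≡ just s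

IsGm : ℕ → ℕ → ℤ → Set
IsGm m n s = Achievable m n s × (∀ (s' : ℤ) → Achievable m n s' → s ≤ℤ s')

-- A sorted sequence that starts and ends at n is constant: n repeated t times, with
-- 1 ≤ t < m; and n is automatically minimal, since a sorted sequence ends at or above
-- its head. So g_m(n) = n iff n ^ t is an m-th power for some 0 < t < m.
-- By Bézout this makes n ^ g an m-th power for g = gcd t m, a proper divisor of m,
-- and then n = c ^ (m / g) with gcd (m / g) m = m / g > 1. Conversely, if n = k ^ d
-- and g = gcd d m > 1, then n ^ (m / g) = (k ^ (d / g)) ^ m with 0 < m / g < m.
module Submission where

open import Defs
open import Data.Nat using (ℕ; _≤_; _<_; _^_; zero; suc; s≤s; z≤n; _∸_; _*_; _+_; _/_; NonZero; ≢-nonZero; ≢-nonZero⁻¹; >-nonZero; >-nonZero⁻¹)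
open import Data.Integer using (+_)
open import Data.Product using (∃; ∃-syntax; _×_; _,_)
open import Function.Bundles using (_⇔_; mk⇔)
open import Relation.Binary.PropositionalEquality

open import Data.Nat.Properties
open import Data.Nat.Divisibility
open import Data.Nat.DivMod using (m/n*n≡m)
open import Data.Nat.GCD using (gcd; gcd[m,n]∣m; gcd[m,n]∣n; gcd[m,n]≢0; gcd-greatest; gcd-GCD; module Bézout)
import Data.Integer as ℤ
import Data.Integer.Properties as ℤ
open import Data.List using ([]; _∷_; replicate; length; last)
open import Data.List.Properties using (length-replicate; length-filter; filter-all)
open import Data.List.Relation.Unary.All.Properties using (replicate⁺)
open import Data.List.Relation.Unary.Linked using ([]; [-]; _∷_)
open import Data.List.Relation.Unary.Sorted.TotalOrder ℤ.≤-totalOrder using (Sorted)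
open import Data.Maybe using (just)
open import Data.Nat.Coprimality using (Coprime; coprime-divisor; coprime-/gcd)
open import Data.Sum using (inj₁)
open ≡-Reasoning

IsPower : ℕ → ℕ → Set
IsPower m x = ∃[ r ] x ≡ r ^ m

^-distribʳ-* : ∀ m n o → (m * n) ^ o ≡ m ^ o * n ^ o
^-distribʳ-* m n zero    = refl
^-distribʳ-* m n (suc o) = begin
  m * n * (m * n) ^ o      ≡⟨ cong (m * n *_) (^-distribʳ-* m n o) ⟩
  m * n * (m ^ o * n ^ o)  ≡⟨ [m*n]*[o*p]≡[m*o]*[n*p] m n (m ^ o) (n ^ o) ⟩
  m * m ^ o * (n * n ^ o)  ∎

m∣m^n : ∀ m n .{{_ : NonZero n}} → m ∣ m ^ n
m∣m^n m (suc n) = m∣m*n (m ^ n)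

coprime-∣^⇒≡1 : ∀ {m n} → Coprime m n → ∀ o → m ∣ n ^ o → m ≡ 1
coprime-∣^⇒≡1 cop zero    m∣1   = ∣1⇒≡1 m∣1
coprime-∣^⇒≡1 cop (suc o) m∣nⁿ⁺¹ = coprime-∣^⇒≡1 cop o (coprime-divisor cop m∣nⁿ⁺¹)

-- Dividing out g = gcd m o leaves coprime m / g and o / g, and then m / g must be 1.
m^n∣o^n⇒m∣o : ∀ m n o .{{_ : NonZero n}} → m ^ n ∣ o ^ n → m ∣ o
m^n∣o^n⇒m∣o zero n o 0ⁿ∣oⁿ = subst (0 ∣_) (sym o≡0) ∣-refl
  where
  o≡0 : o ≡ 0
  o≡0 = m^n≡0⇒m≡0 o n (0∣⇒≡0 (∣-trans (m∣m^n 0 n) 0ⁿ∣oⁿ))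
m^n∣o^n⇒m∣o m@(suc _) n o mⁿ∣oⁿ = subst (_∣ o) (sym m≡g) (gcd[m,n]∣n m o)
  where
  g : ℕ
  g = gcd m o
  instance
    g≢0 : NonZero g
    g≢0 = ≢-nonZero (gcd[m,n]≢0 m o (inj₁ λ ()))
  split : ∀ {x} → g ∣ x → x ^ n ≡ (x / g) ^ n * g ^ n
  split {x} g∣x = trans (cong (_^ n) (sym (m/n*n≡m g∣x))) (^-distribʳ-* (x / g) g n)
  quotients : (m / g) ^ n ∣ (o / g) ^ n
  quotients = *-cancelʳ-∣ (g ^ n) {{m^n≢0 g n}}
    (subst₂ _∣_ (split (gcd[m,n]∣m m o)) (split (gcd[m,n]∣n m o)) mⁿ∣oⁿ)
  m/g≡1 : m / g ≡ 1
  m/g≡1 = coprime-∣^⇒≡1 (coprime-/gcd m o) n (∣-trans (m∣m^n (m / g) n) quotients)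
  m≡g : m ≡ g
  m≡g = begin
    m          ≡⟨ m/n*n≡m (gcd[m,n]∣m m o) ⟨
    m / g * g  ≡⟨ cong (_* g) m/g≡1 ⟩
    1 * g      ≡⟨ *-identityˡ g ⟩
    g          ∎

m^n≡o^n⇒m≡o : ∀ m n o .{{_ : NonZero n}} → m ^ n ≡ o ^ n → m ≡ o
m^n≡o^n⇒m≡o m n o eq = ∣-antisym
  (m^n∣o^n⇒m∣o m n o (subst (m ^ n ∣_) eq ∣-refl))
  (m^n∣o^n⇒m∣o o n m (subst (_∣ m ^ n) eq ∣-refl))

m∣n⇒gcd[m,n]≡m : ∀ {m n} → m ∣ n → gcd m n ≡ m
m∣n⇒gcd[m,n]≡m m∣n = ∣-antisym (gcd[m,n]∣m _ _) (gcd-greatest ∣-refl m∣n)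

isPower-^-divisor : ∀ {m n g} .{{_ : NonZero g}} (g∣m : g ∣ m) →
                    IsPower m (n ^ g) → IsPower (quotient g∣m) n
isPower-^-divisor {n = n} {g} (divides q refl) (c , nᵍ≡cᵐ) =
  c , m^n≡o^n⇒m≡o n g (c ^ q) (trans nᵍ≡cᵐ (sym (^-*-assoc c q g)))

isPower-^ : ∀ {m x} → IsPower m x → ∀ e → IsPower m (x ^ e)
isPower-^ {m} (r , refl) e = r ^ e , (begin
  (r ^ m) ^ e  ≡⟨ ^-*-assoc r m e ⟩
  r ^ (m * e)  ≡⟨ cong (r ^_) (*-comm m e) ⟩
  r ^ (e * m)  ≡⟨ ^-*-assoc r e m ⟨
  (r ^ e) ^ m  ∎)

isPower-cancelʳ : ∀ {m a b} .{{_ : NonZero b}} .{{_ : NonZero m}} →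
                  IsPower m (a * b) → IsPower m b → IsPower m a
isPower-cancelʳ {m} {a} (y , ab≡yᵐ) (x , refl)
  with m^n∣o^n⇒m∣o x m y (divides a (sym ab≡yᵐ))
... | divides c refl = c , *-cancelʳ-≡ a (c ^ m) (x ^ m)
  (trans ab≡yᵐ (^-distribʳ-* c x m))

-- The exponents e for which n ^ e is an m-th power contain t and m and are closed
-- under multiples and (as n ≢ 0) under cancellation, so Bézout puts gcd t m among them.
isPower-^gcd : ∀ {m n t} .{{_ : NonZero m}} .{{_ : NonZero n}} →
               IsPower m (n ^ t) → IsPower m (n ^ gcd t m)
isPower-^gcd {m} {n} {t} nᵗ = fromBézout (Bézout.identity (gcd-GCD t m))
  where
  g : ℕ
  g = gcd t m
  multiple : ∀ {d} → IsPower m (n ^ d) → ∀ e → IsPower m (n ^ (e * d))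
  multiple {d} nᵈ e = subst (IsPower m)
    (trans (^-*-assoc n d e) (cong (n ^_) (*-comm d e))) (isPower-^ {m} nᵈ e)
  cancel : ∀ {d e} → g + d ≡ e → IsPower m (n ^ d) → IsPower m (n ^ e) → IsPower m (n ^ g)
  cancel {d} g+d≡e nᵈ nᵉ = isPower-cancelʳ {{m^n≢0 n d}}
    (subst (IsPower m) (trans (cong (n ^_) (sym g+d≡e)) (^-distribˡ-+-* n g d)) nᵉ) nᵈ
  fromBézout : Bézout.Identity g t m → IsPower m (n ^ g)
  fromBézout (Bézout.+- x y eq) = cancel eq (multiple {m} (n , refl) y) (multiple nᵗ x)
  fromBézout (Bézout.-+ x y eq) = cancel eq (multiple nᵗ x) (multiple {m} (n , refl) y)

PowerBelow : ℕ → ℕ → Set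
PowerBelow m n = ∃[ t ] (1 ≤ t × t < m × IsPower m (n ^ t))

isPower-^⇒perfectPower : ∀ {m n t} .{{_ : NonZero n}} .{{_ : NonZero t}} →
                         t < m → IsPower m (n ^ t) → ∃[ k ] ∃[ d ] (n ≡ k ^ d × 1 < gcd d m)
isPower-^⇒perfectPower {m} {n} {t} t<m nᵗ =
  let c , n≡cᵠ = isPower-^-divisor g∣m (isPower-^gcd {m} {n} {t} nᵗ)
  in c , q , n≡cᵠ , subst (1 <_) (sym (m∣n⇒gcd[m,n]≡m (quotient-∣ g∣m))) (quotient>1 g∣m g<m)
  where
  instance
    m≢0 : NonZero m
    m≢0 = >-nonZero (<-trans (>-nonZero⁻¹ t) t<m)
    g≢0 : NonZero (gcd t m)
    g≢0 = ≢-nonZero (gcd[m,n]≢0 t m (inj₁ (≢-nonZero⁻¹ t)))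
  g∣m : gcd t m ∣ m
  g∣m = gcd[m,n]∣n t m
  q : ℕ
  q = quotient g∣m
  g<m : gcd t m < m
  g<m = ≤-<-trans (∣⇒≤ (gcd[m,n]∣m t m)) t<m

powerBelow⇒perfectPower : ∀ {m n} → PowerBelow m n → ∃[ k ] ∃[ d ] (n ≡ k ^ d × 1 < gcd d m)
powerBelow⇒perfectPower {zero}      (_ , _ , () , _)
powerBelow⇒perfectPower {m@(suc _)} {zero} (_ , 1≤t , t<m , _) =
  0 , m , refl , subst (1 <_) (sym (m∣n⇒gcd[m,n]≡m ∣-refl)) (≤-<-trans 1≤t t<m)
powerBelow⇒perfectPower {n = suc _} (_ , 1≤t , t<m , nᵗ) =
  isPower-^⇒perfectPower {{_}} {{>-nonZero 1≤t}} t<m nᵗ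

perfectPower⇒powerBelow : ∀ {m n} .{{_ : NonZero m}} →
                          ∃[ k ] ∃[ d ] (n ≡ k ^ d × 1 < gcd d m) → PowerBelow m n
perfectPower⇒powerBelow {m} (k , d , refl , 1<g) = t , >-nonZero⁻¹ t , t<m , k ^ d′ , (begin
  (k ^ d) ^ t         ≡⟨ cong (λ e → (k ^ e) ^ t) (m∣n⇒n≡quotient*m g∣d) ⟩
  (k ^ (d′ * g)) ^ t  ≡⟨ cong (_^ t) (^-*-assoc k d′ g) ⟨
  ((k ^ d′) ^ g) ^ t  ≡⟨ ^-*-assoc (k ^ d′) g t ⟩
  (k ^ d′) ^ (g * t)  ≡⟨ cong ((k ^ d′) ^_) (trans (*-comm g t) (sym m≡t*g)) ⟩
  (k ^ d′) ^ m        ∎)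
  where
  g : ℕ
  g = gcd d m
  g∣d : g ∣ d
  g∣d = gcd[m,n]∣m d m
  g∣m : g ∣ m
  g∣m = gcd[m,n]∣n d m
  d′ t : ℕ
  d′ = quotient g∣d
  t = quotient g∣m
  m≡t*g : m ≡ t * g
  m≡t*g = m∣n⇒n≡quotient*m g∣m
  instance
    t≢0 : NonZero t
    t≢0 = quotient≢0 g∣m
  t<m : t < m
  t<m = subst (t <_) (sym m≡t*g) (m<m*n t g 1<g)

pos-^ : ∀ m n → (+ m) ℤ.^ n ≡ + (m ^ n)
pos-^ m zero    = refl
pos-^ m (suc n) = trans (cong (+ m ℤ.*_) (pos-^ m n)) (sym (ℤ.pos-* m (m ^ n)))

prodℤ-replicate : ∀ n x → prodℤ (replicate n x) ≡ x ℤ.^ n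
prodℤ-replicate zero    x = refl
prodℤ-replicate (suc n) x = cong (x ℤ.*_) (prodℤ-replicate n x)

occ-replicate : ∀ n x → occ x (replicate n x) ≡ n
occ-replicate n x = trans (cong length (filter-all (ℤ._≟ x) (replicate⁺ n refl))) (length-replicate n)

occ≤length : ∀ x xs → occ x xs ≤ length xs
occ≤length x = length-filter (ℤ._≟ x)

last-replicate : ∀ n (x : ℤ.ℤ) → last (replicate (suc n) x) ≡ just x
last-replicate zero    x = refl
last-replicate (suc n) x = last-replicate n x

sorted-replicate : ∀ n x → Sorted (replicate n x)
sorted-replicate zero          x = []
sorted-replicate (suc zero)    x = [-]
sorted-replicate (suc (suc n)) x = ℤ.≤-refl ∷ sorted-replicate (suc n) x

head≤last : ∀ {x y xs} → Sorted (x ∷ xs) → last (x ∷ xs) ≡ just y → x ℤ.≤ y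
head≤last {xs = []}    _           refl    = ℤ.≤-refl
head≤last {xs = _ ∷ _} (x≤x′ ∷ xs↑) last≡y = ℤ.≤-trans x≤x′ (head≤last xs↑ last≡y)

sorted-head≡last⇒replicate : ∀ {x xs} → Sorted (x ∷ xs) → last (x ∷ xs) ≡ just x →
                             x ∷ xs ≡ replicate (suc (length xs)) x
sorted-head≡last⇒replicate {xs = []}    _           _       = refl
sorted-head≡last⇒replicate {x} {_ ∷ _} (x≤x′ ∷ xs↑) last≡x
  with refl ← ℤ.≤-antisym x≤x′ (head≤last xs↑ last≡x)
  = cong (x ∷_) (sorted-head≡last⇒replicate xs↑ last≡x)

replicate-isMProductSeq : ∀ {m n t} → t ≤ m ∸ 1 → IsPower m (n ^ t) →
                          IsMProductSeq m (replicate t (+ n))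
replicate-isMProductSeq {m} {n} {t} t≤m∸1 (r , nᵗ≡rᵐ) = record
  { sorted   = sorted-replicate t (+ n)
  ; power    = r , (begin
      prodℤ (replicate t (+ n))  ≡⟨ prodℤ-replicate t (+ n) ⟩
      (+ n) ℤ.^ t                ≡⟨ pos-^ n t ⟩
      + (n ^ t)                  ≡⟨ cong +_ nᵗ≡rᵐ ⟩
      + (r ^ m)                  ≡⟨ pos-^ r m ⟨
      (+ r) ℤ.^ m                ∎)
  ; multiple = λ x → ≤-trans (occ≤length x (replicate t (+ n)))
                       (subst (_≤ m ∸ 1) (sym (length-replicate t)) t≤m∸1)
  }

replicate-isMProductSeq⁻ : ∀ {m n t} → IsMProductSeq m (replicate t (+ n)) →
                           t ≤ m ∸ 1 × IsPower m (n ^ t)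
replicate-isMProductSeq⁻ {m} {n} {t} record { power = r , prodℤ≡rᵐ ; multiple = multiple } =
  subst (_≤ m ∸ 1) (occ-replicate t (+ n)) (multiple (+ n)) , r , ℤ.+-injective (begin
    + (n ^ t)                  ≡⟨ pos-^ n t ⟨
    (+ n) ℤ.^ t                ≡⟨ prodℤ-replicate t (+ n) ⟨
    prodℤ (replicate t (+ n))  ≡⟨ prodℤ≡rᵐ ⟩
    (+ r) ℤ.^ m                ≡⟨ pos-^ r m ⟩
    + (r ^ m)                  ∎)

achievable⇒head≤ : ∀ {m n s} → Achievable m n s → + n ℤ.≤ s
achievable⇒head≤ (_ ∷ _ , seq , refl , last≡s) = head≤last (IsMProductSeq.sorted seq) last≡s

achievable-self⇒powerBelow : ∀ {m n} .{{_ : NonZero m}} → Achievable m n (+ n) → PowerBelow m n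
achievable-self⇒powerBelow {m} {n} (_ ∷ xs , seq , refl , last≡n)
  with t≤m∸1 , nᵗ ← replicate-isMProductSeq⁻ (subst (IsMProductSeq m)
                      (sorted-head≡last⇒replicate (IsMProductSeq.sorted seq) last≡n) seq)
  = suc (length xs) , s≤s z≤n , m≤pred[n]⇒suc[m]≤n t≤m∸1 , nᵗ

powerBelow⇒isGm-self : ∀ {m n} → PowerBelow m n → IsGm m n (+ n)
powerBelow⇒isGm-self {m} {n} (suc t , _ , t<m , nᵗ) =
  (replicate (suc t) (+ n) , replicate-isMProductSeq (<⇒≤pred t<m) nᵗ , refl , last-replicate t (+ n))
  , λ _ → achievable⇒head≤

lemma2p3 : ∀ (m : ℕ) → 2 ≤ m → ∀ (n : ℕ) →
    IsGm m n (+ n) ⇔ (∃[ k ] ∃[ d ] (n ≡ k ^ d × 1 < gcd d m))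
lemma2p3 m 2≤m n = mk⇔
  (λ (achievable , _) → powerBelow⇒perfectPower (achievable-self⇒powerBelow achievable))
  (λ perfect → powerBelow⇒isGm-self (perfectPower⇒powerBelow perfect))
  where
  instance
    m≢0 : NonZero m
    m≢0 = >-nonZero (≤-trans (s≤s z≤n) 2≤m)
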